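{- Let $r,n$ be positive integers and $c>0$ with $cn$ an integer. Let $G$ be a tripartite graph with parts $V_0,V_1,V_2$, where $|V_1|=|V_2|=n$, $|V_0|=cn$, and every vertex of $V_1$ is adjacent to every vertex of $V_2$. Suppose the edges of $G$ are colored with $r$ colors in such a way that there is a collection of $n^2$ pairwise edge-disjoint monochromatic triangles of $G$ which cover all edges between $V_1$ and $V_2$. Then $G$ contains at least $(4cr)^{ -2^{r+3}}n^3$ monochromatic triangles.
   Context: A tripartite graph with parts $V_0,V_1,V_2$ has no edges inside any part. A triangle is monochromatic if all three of its edges receive the same color. -}

module Defs where

open import Data.Nat using (ℕ; zero; suc; _+_)
open import Data.Fin using (Fin; zero; suc)
open import Data.Fin.Properties using (_≟_)
open import Data.Bool using (Bool; true; false; _∧_; if_then_else_)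
open import Data.Product using (_×_; _,_)
open import Data.Sum using (_⊎_)
open import Relation.Nullary.Decidable using (⌊_⌋)
open import Relation.Binary.PropositionalEquality using (_≡_)

-- There are no edges inside a part, so the graph is determined by the
-- three bipartite adjacency relations between the parts.
-- An r-edge-colouring assigns a colour in Fin r to every cross pair;
-- only the values on actual edges are ever used.
record TriGraph (m n r : ℕ) : Set where
  field
    adj01 : Fin m → Fin n → Bool
    adj02 : Fin m → Fin n → Bool
    adj12 : Fin n → Fin n → Bool
    col01 : Fin m → Fin n → Fin r
    col02 : Fin m → Fin n → Fin r
    col12 : Fin n → Fin n → Fin r

open TriGraph public

-- Triangles of a tripartite graph have exactly one vertex in each part;
-- a triple (a , b , c) ∈ V₀ × V₁ × V₂ spans a triangle iff all three edges exist.
Triple : ℕ → ℕ → Set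
Triple m n = Fin m × Fin n × Fin n

isTriangle : ∀ {m n r} → TriGraph m n r → Fin m → Fin n → Fin n → Bool
isTriangle G a b c = adj01 G a b ∧ adj02 G a c ∧ adj12 G b c

isMonoTriangle : ∀ {m n r} → TriGraph m n r → Fin m → Fin n → Fin n → Bool
isMonoTriangle G a b c =
  isTriangle G a b c ∧ ⌊ col01 G a b ≟ col02 G a c ⌋ ∧ ⌊ col01 G a b ≟ col12 G b c ⌋

IsMonoTriangle : ∀ {m n r} → TriGraph m n r → Triple m n → Set
IsMonoTriangle G (a , b , c) = isMonoTriangle G a b c ≡ true

ShareEdge : ∀ {m n} → Triple m n → Triple m n → Set
ShareEdge (a , b , c) (a' , b' , c') =
  ((a ≡ a') × (b ≡ b')) ⊎ ((a ≡ a') × (c ≡ c')) ⊎ ((b ≡ b') × (c ≡ c'))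

sumFin : (k : ℕ) → (Fin k → ℕ) → ℕ
sumFin zero f = 0
sumFin (suc k) f = f zero + sumFin k (λ i → f (suc i))

monoTriangleCount : ∀ {m n r} → TriGraph m n r → ℕ
monoTriangleCount {m} {n} G =
  sumFin m λ a → sumFin n λ b → sumFin n λ c →
    if isMonoTriangle G a b c then 1 else 0

-- Give every edge bc of V₁ × V₂ the label (a, χ) of its decomposition triangle: apex a ∈ V₀ and colour χ.
-- Edge-disjointness makes every label class a partial matching, so its sets of rows and columns both have the
-- size d_{aχ} of the class, and any edge of colour χ joining one of its rows to one of its columns closes a
-- monochromatic triangle with a. For d × d boxes B × C and a palette S of still available colours one proves,
-- by induction on |S|, that d^{3 + q} ≤ (4 m r)^q (X + d u), where X counts the monochromatic triangles seen in
-- this way and u the edges of B × C whose colour is not in S. Write d² = e + u, with e the edges coloured from S.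
-- The induction step applies the hypothesis to the box of every label class with χ removed from the palette;
-- the power-mean inequality gives e^P ≤ (m r)^{P-1} Σ d_{aχ}^P, and Bernoulli's inequality recovers (d²)^P from
-- e^P at the cost of a term linear in u. With S all r colours, u = 0 and q ≤ 2^{r+3}.
module Submission where

open import Data.Bool using (Bool; true; false; T; _∧_; _∨_; not; if_then_else_)
open import Data.Bool.Properties using (T-∧; T-∨; T-≡; T?; ∧-identityʳ)
open import Data.Empty using (⊥-elim)
open import Data.Fin using (Fin; zero; suc)
open import Data.Fin.Properties as Fin using (_≟_)
open import Data.Nat using (ℕ; zero; suc; _+_; _*_; _^_; _≤_; z≤n; s≤s; s≤s⁻¹)
open import Data.Nat.Properties hiding (_≟_)
open import Algebra.Properties.Semiring.Sum +-*-semiring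
  using (sum; sum-syntax; sum-cong-≗; sum-replicate-zero; ∑-distrib-+; ∑-comm; *-distribˡ-sum; *-distribʳ-sum)
open import Data.Nat.Tactic.RingSolver using (solve-∀)
open import Data.Product using (_×_; _,_; ∃; proj₁; proj₂)
open import Data.Sum using (inj₁; inj₂)
open import Data.Unit using (tt)
open import Function.Base using (case_of_)
open import Function.Bundles using (Equivalence)
open import Relation.Binary.PropositionalEquality
  using (_≡_; _≢_; refl; sym; trans; cong; cong₂; subst; subst₂; module ≡-Reasoning)
open import Relation.Nullary using (¬_)
open import Relation.Nullary.Decidable using (does; yes; no; map′; does-≡; ⌊_⌋; toWitness; fromWitness)

open import Defs

sumFin≡sum : ∀ k (f : Fin k → ℕ) → sumFin k f ≡ sum f
sumFin≡sum zero    f = refl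
sumFin≡sum (suc k) f = cong (f zero +_) (sumFin≡sum k (λ i → f (suc i)))

sum-mono-≤ : ∀ {k} {f g : Fin k → ℕ} → (∀ i → f i ≤ g i) → sum f ≤ sum g
sum-mono-≤ {zero}  f≤g = z≤n
sum-mono-≤ {suc k} f≤g = +-mono-≤ (f≤g zero) (sum-mono-≤ (λ i → f≤g (suc i)))

sum-const : ∀ k c → ∑[ i < k ] c ≡ k * c
sum-const zero    c = refl
sum-const (suc k) c = cong (c +_) (sum-const k c)

∑∑-product : ∀ {k l} (f : Fin k → ℕ) (g : Fin l → ℕ) →
             ∑[ i < k ] ∑[ j < l ] (f i * g j) ≡ sum f * sum g
∑∑-product {k} {l} f g = begin
  ∑[ i < k ] ∑[ j < l ] (f i * g j) ≡⟨ sum-cong-≗ (λ i → sym (*-distribˡ-sum (f i) g)) ⟩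
  ∑[ i < k ] (f i * sum g)          ≡⟨ sym (*-distribʳ-sum (sum g) f) ⟩
  sum f * sum g                     ∎
  where open ≡-Reasoning

∑∑-zero : ∀ {k l} (f : Fin k → Fin l → ℕ) → (∀ i j → f i j ≡ 0) → ∑[ i < k ] ∑[ j < l ] f i j ≡ 0
∑∑-zero {k} {l} f f≡0 =
  trans (sum-cong-≗ (λ i → trans (sum-cong-≗ (f≡0 i)) (sum-replicate-zero l))) (sum-replicate-zero k)

∑∑-distrib-+ : ∀ {k l} (f g : Fin k → Fin l → ℕ) →
               ∑[ i < k ] ∑[ j < l ] (f i j + g i j) ≡ ∑[ i < k ] ∑[ j < l ] f i j + ∑[ i < k ] ∑[ j < l ] g i j
∑∑-distrib-+ f g =
  trans (sum-cong-≗ (λ i → ∑-distrib-+ (f i) (g i))) (∑-distrib-+ (λ i → sum (f i)) (λ i → sum (g i)))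

*-distribˡ-∑∑ : ∀ {k l} x (f : Fin k → Fin l → ℕ) →
                x * ∑[ i < k ] ∑[ j < l ] f i j ≡ ∑[ i < k ] ∑[ j < l ] (x * f i j)
*-distribˡ-∑∑ x f = trans (*-distribˡ-sum x (λ i → sum (f i))) (sum-cong-≗ (λ i → *-distribˡ-sum x (f i)))

*-distribʳ-∑∑ : ∀ {k l} x (f : Fin k → Fin l → ℕ) →
                (∑[ i < k ] ∑[ j < l ] f i j) * x ≡ ∑[ i < k ] ∑[ j < l ] (f i j * x)
*-distribʳ-∑∑ x f = trans (*-distribʳ-sum x (λ i → sum (f i))) (sum-cong-≗ (λ i → *-distribʳ-sum x (f i)))

∑∑-comm-∑∑ : ∀ {k l p o} (F : Fin k → Fin l → Fin p → Fin o → ℕ) →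
             ∑[ a < k ] ∑[ χ < l ] ∑[ b < p ] ∑[ c < o ] F a χ b c ≡
             ∑[ b < p ] ∑[ c < o ] ∑[ a < k ] ∑[ χ < l ] F a χ b c
∑∑-comm-∑∑ {k} {l} {p} {o} F = begin
  ∑[ a < k ] ∑[ χ < l ] ∑[ b < p ] ∑[ c < o ] F a χ b c
    ≡⟨ sum-cong-≗ (λ a → ∑-comm (λ χ b → ∑[ c < o ] F a χ b c)) ⟩
  ∑[ a < k ] ∑[ b < p ] ∑[ χ < l ] ∑[ c < o ] F a χ b c
    ≡⟨ sum-cong-≗ (λ a → sum-cong-≗ (λ b → ∑-comm (λ χ c → F a χ b c))) ⟩
  ∑[ a < k ] ∑[ b < p ] ∑[ c < o ] ∑[ χ < l ] F a χ b c
    ≡⟨ ∑-comm (λ a b → ∑[ c < o ] ∑[ χ < l ] F a χ b c) ⟩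
  ∑[ b < p ] ∑[ a < k ] ∑[ c < o ] ∑[ χ < l ] F a χ b c
    ≡⟨ sum-cong-≗ (λ b → ∑-comm (λ a c → ∑[ χ < l ] F a χ b c)) ⟩
  ∑[ b < p ] ∑[ c < o ] ∑[ a < k ] ∑[ χ < l ] F a χ b c ∎
  where open ≡-Reasoning

T-∧-intro : ∀ {x y} → T x → T y → T (x ∧ y)
T-∧-intro Tx Ty = Equivalence.from T-∧ (Tx , Ty)

T-∧-elim : ∀ x {y} → T (x ∧ y) → T x × T y
T-∧-elim x = Equivalence.to (T-∧ {x})

𝟙 : Bool → ℕ
𝟙 b = if b then 1 else 0

𝟙≤1 : ∀ x → 𝟙 x ≤ 1
𝟙≤1 false = z≤n
𝟙≤1 true  = s≤s z≤n

𝟙-mono : ∀ {x y} → (T x → T y) → 𝟙 x ≤ 𝟙 y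
𝟙-mono {false}         x⇒y = z≤n
𝟙-mono {true} {true}   x⇒y = ≤-refl
𝟙-mono {true} {false}  x⇒y = ⊥-elim (x⇒y tt)

𝟙-false : ∀ {x} → ¬ T x → 𝟙 x ≡ 0
𝟙-false {false} ¬x = refl
𝟙-false {true}  ¬x = ⊥-elim (¬x tt)

𝟙-∧ : ∀ x y → 𝟙 (x ∧ y) ≡ 𝟙 x * 𝟙 y
𝟙-∧ false y = refl
𝟙-∧ true  y = sym (+-identityʳ (𝟙 y))

𝟙-∧₃ : ∀ x y z → 𝟙 (x ∧ y ∧ z) ≡ 𝟙 x * 𝟙 y * 𝟙 z
𝟙-∧₃ x y z =
  trans (𝟙-∧ x (y ∧ z)) (trans (cong (𝟙 x *_) (𝟙-∧ y z)) (sym (*-assoc (𝟙 x) (𝟙 y) (𝟙 z))))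

𝟙-restrict : ∀ x y z {x′ y′} → (T x → T x′) → (T y → T y′) →
             𝟙 (x ∧ y ∧ z) ≤ 𝟙 x * 𝟙 (x′ ∧ y′ ∧ z)
𝟙-restrict false y z x⇒x′ y⇒y′ = z≤n
𝟙-restrict true  y z x⇒x′ y⇒y′ = subst (𝟙 (y ∧ z) ≤_) (sym (+-identityʳ _)) (𝟙-mono λ yz →
  let (Ty , Tz) = T-∧-elim y yz in T-∧-intro (x⇒x′ tt) (T-∧-intro (y⇒y′ Ty) Tz))

𝟙-split : ∀ x y s → 𝟙 (x ∧ y ∧ s) + 𝟙 (x ∧ y ∧ not s) ≡ 𝟙 x * 𝟙 y
𝟙-split false y     s     = refl
𝟙-split true  false s     = refl
𝟙-split true  true  false = refl
𝟙-split true  true  true  = refl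

𝟙-cellOff-split : ∀ x y s e {x′ y′} → (T x → T x′) → (T y → T y′) →
                  𝟙 (x ∧ y ∧ not (s ∧ not e)) ≤ 𝟙 (x ∧ y ∧ e) + 𝟙 x * 𝟙 (x′ ∧ y′ ∧ not s)
𝟙-cellOff-split false y     s     e                      x⇒x′ y⇒y′ = z≤n
𝟙-cellOff-split true  false s     e                      x⇒x′ y⇒y′ = z≤n
𝟙-cellOff-split true  true  s     e     {false}          x⇒x′ y⇒y′ = ⊥-elim (x⇒x′ tt)
𝟙-cellOff-split true  true  s     e     {true} {false}   x⇒x′ y⇒y′ = ⊥-elim (y⇒y′ tt)
𝟙-cellOff-split true  true  true  true  {true} {true}    x⇒x′ y⇒y′ = s≤s z≤n
𝟙-cellOff-split true  true  true  false {true} {true}    x⇒x′ y⇒y′ = z≤n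
𝟙-cellOff-split true  true  false e     {true} {true}    x⇒x′ y⇒y′ = m≤n+m 1 (𝟙 e)

∣_∣ : ∀ {k} → (Fin k → Bool) → ℕ
∣ P ∣ = ∑[ i < _ ] 𝟙 (P i)

∣∣-mono : ∀ {k} {P Q : Fin k → Bool} → (∀ i → T (P i) → T (Q i)) → ∣ P ∣ ≤ ∣ Q ∣
∣∣-mono P⊆Q = sum-mono-≤ (λ i → 𝟙-mono (P⊆Q i))

∣∣≤ : ∀ {k} (P : Fin k → Bool) → ∣ P ∣ ≤ k
∣∣≤ {k} P = begin
  ∣ P ∣         ≤⟨ sum-mono-≤ (λ i → 𝟙≤1 (P i)) ⟩
  ∑[ i < k ] 1  ≡⟨ sum-const k 1 ⟩
  k * 1         ≡⟨ *-identityʳ k ⟩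
  k             ∎
  where open ≤-Reasoning

∣all∣ : ∀ k → ∣ (λ (_ : Fin k) → true) ∣ ≡ k
∣all∣ k = trans (sum-const k 1) (*-identityʳ k)

any : ∀ {k} → (Fin k → Bool) → Bool
any {zero}  P = false
any {suc k} P = P zero ∨ any (λ i → P (suc i))

any-intro : ∀ {k} (P : Fin k → Bool) i → T (P i) → T (any P)
any-intro P zero    Pi = Equivalence.from T-∨ (inj₁ Pi)
any-intro P (suc i) Pi = Equivalence.from (T-∨ {P zero}) (inj₂ (any-intro (λ j → P (suc j)) i Pi))

any-elim : ∀ {k} (P : Fin k → Bool) → T (any P) → ∃ λ i → T (P i)
any-elim {suc k} P h with Equivalence.to (T-∨ {P zero}) h
... | inj₁ P0 = zero , P0
... | inj₂ Ps with any-elim (λ j → P (suc j)) Ps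
...   | i , Pi = suc i , Pi

𝟙-any≤∣∣ : ∀ {k} (P : Fin k → Bool) → 𝟙 (any P) ≤ ∣ P ∣
𝟙-any≤∣∣ {zero}  P = z≤n
𝟙-any≤∣∣ {suc k} P with P zero
... | true  = s≤s z≤n
... | false = 𝟙-any≤∣∣ (λ i → P (suc i))

1≤∣∣ : ∀ {k} (P : Fin k → Bool) {i} → T (P i) → 1 ≤ ∣ P ∣
1≤∣∣ P {i} Pi = ≤-trans (𝟙-mono {true} (λ _ → any-intro P i Pi)) (𝟙-any≤∣∣ P)

∣∣≡𝟙-any : ∀ {k} (P : Fin k → Bool) → (∀ {i j} → T (P i) → T (P j) → i ≡ j) → ∣ P ∣ ≡ 𝟙 (any P)
∣∣≡𝟙-any {zero}  P unique = refl
∣∣≡𝟙-any {suc k} P unique with P zero in P0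
... | true  = cong suc (trans (sum-cong-≗ tail-false) (sum-replicate-zero k))
  where
  tail-false : ∀ i → 𝟙 (P (suc i)) ≡ 0
  tail-false i with P (suc i) in Pi
  ... | false = refl
  ... | true  with () ← unique (subst T (sym P0) tt) (subst T (sym Pi) tt)
... | false = ∣∣≡𝟙-any (λ i → P (suc i)) (λ Pi Pj → Fin.suc-injective (unique Pi Pj))

_==_ : ∀ {k} → Fin k → Fin k → Bool
i == j = does (i ≟ j)

==-sound : ∀ {k} {i j : Fin k} → T (i == j) → i ≡ j
==-sound {i = i} {j} h with i ≟ j
... | yes i≡j = i≡j

==-refl : ∀ {k} (i : Fin k) → T (i == i)
==-refl i with i ≟ i
... | yes _  = tt
... | no i≢i = i≢i refl

==-comm : ∀ {k} (i j : Fin k) → (i == j) ≡ (j == i)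
==-comm i j = does-≡ (map′ sym sym (i ≟ j)) (j ≟ i)

≡⇒T== : ∀ {k} {i j : Fin k} → i ≡ j → T (i == j)
≡⇒T== {i = i} refl = ==-refl i

∑-select : ∀ {k} (j : Fin k) (f : Fin k → ℕ) → ∑[ i < k ] (𝟙 (j == i) * f i) ≡ f j
∑-select {suc k} zero    f =
  trans (cong₂ _+_ (+-identityʳ (f zero)) (sum-replicate-zero k)) (+-identityʳ (f zero))
∑-select {suc k} (suc j) f = ∑-select j (λ i → f (suc i))

∑-𝟙== : ∀ {k} (j : Fin k) → ∑[ i < k ] 𝟙 (j == i) ≡ 1
∑-𝟙== {k} j =
  trans (sum-cong-≗ (λ i → sym (*-identityʳ (𝟙 (j == i))))) (∑-select j (λ _ → 1))

_∖_ : ∀ {k} → (Fin k → Bool) → Fin k → (Fin k → Bool)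
(S ∖ χ) j = S j ∧ not (j == χ)

∣∖∣ : ∀ {k} (S : Fin k → Bool) {χ} → T (S χ) → suc ∣ S ∖ χ ∣ ≡ ∣ S ∣
∣∖∣ {k} S {χ} Sχ = begin
  suc ∣ S ∖ χ ∣
    ≡⟨ +-comm 1 ∣ S ∖ χ ∣ ⟩
  ∣ S ∖ χ ∣ + 1
    ≡⟨ cong (∣ S ∖ χ ∣ +_) (trans (sum-cong-≗ (λ j → cong 𝟙 (==-comm j χ))) (∑-𝟙== χ)) ⟨
  ∣ S ∖ χ ∣ + ∑[ j < k ] 𝟙 (j == χ)
    ≡⟨ ∑-distrib-+ (λ j → 𝟙 ((S ∖ χ) j)) (λ j → 𝟙 (j == χ)) ⟨
  ∑[ j < k ] (𝟙 ((S ∖ χ) j) + 𝟙 (j == χ))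
    ≡⟨ sum-cong-≗ pointwise ⟩
  ∣ S ∣ ∎
  where
  open ≡-Reasoning
  pointwise : ∀ j → 𝟙 ((S ∖ χ) j) + 𝟙 (j == χ) ≡ 𝟙 (S j)
  pointwise j with j ≟ χ
  ... | yes refl rewrite Equivalence.to T-≡ Sχ = refl
  ... | no _       = trans (+-identityʳ _) (cong 𝟙 (∧-identityʳ (S j)))

bernoulli : ∀ s x u → (x + u) ^ suc s ≤ x ^ suc s + suc s * (x + u) ^ s * u
bernoulli zero    x u = ≤-reflexive (identity x u)
  where
  identity : ∀ x u → (x + u) * 1 ≡ x * 1 + 1 * 1 * u
  identity = solve-∀
bernoulli (suc s) x u = begin
  (x + u) * (x + u) ^ suc s
    ≤⟨ *-monoʳ-≤ (x + u) (bernoulli s x u) ⟩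
  (x + u) * (x ^ suc s + suc s * (x + u) ^ s * u)
    ≡⟨ expand (suc s) x u (x ^ suc s) ((x + u) ^ s) ⟩
  x * x ^ suc s + u * x ^ suc s + suc s * ((x + u) * (x + u) ^ s) * u
    ≤⟨ +-monoˡ-≤ _ (+-monoʳ-≤ (x * x ^ suc s) (*-monoʳ-≤ u (^-monoˡ-≤ (suc s) (m≤m+n x u)))) ⟩
  x * x ^ suc s + u * (x + u) ^ suc s + suc s * (x + u) ^ suc s * u
    ≡⟨ collect (suc s) (x * x ^ suc s) u ((x + u) ^ suc s) ⟩
  x ^ suc (suc s) + suc (suc s) * (x + u) ^ suc s * u ∎
  where
  open ≤-Reasoning
  expand : ∀ c x u X Y → (x + u) * (X + c * Y * u) ≡ x * X + u * X + c * ((x + u) * Y) * u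
  expand = solve-∀
  collect : ∀ c X u Y → X + u * Y + c * Y * u ≡ X + (1 + c) * Y * u
  collect = solve-∀

rearrangement-≤ : ∀ a {x y} → x ≤ y → x ^ a * y + y ^ a * x ≤ x ^ suc a + y ^ suc a
rearrangement-≤ a {x} x≤y with t , refl ← m≤n⇒∃[o]m+o≡n x≤y
                             | w , xᵃ+w≡yᵃ ← m≤n⇒∃[o]m+o≡n (^-monoˡ-≤ a x≤y) = begin
  x ^ a * (x + t) + (x + t) ^ a * x          ≡⟨ cong (λ z → x ^ a * (x + t) + z * x) (sym xᵃ+w≡yᵃ) ⟩
  x ^ a * (x + t) + (x ^ a + w) * x          ≤⟨ m≤m+n _ (w * t) ⟩
  x ^ a * (x + t) + (x ^ a + w) * x + w * t  ≡⟨ identity x t (x ^ a) w ⟩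
  x * x ^ a + (x + t) * (x ^ a + w)          ≡⟨ cong (λ z → x * x ^ a + (x + t) * z) xᵃ+w≡yᵃ ⟩
  x ^ suc a + (x + t) ^ suc a                ∎
  where
  open ≤-Reasoning
  identity : ∀ x t X w → X * (x + t) + (X + w) * x + w * t ≡ x * X + (x + t) * (X + w)
  identity = solve-∀

rearrangement : ∀ a x y → x ^ a * y + y ^ a * x ≤ x ^ suc a + y ^ suc a
rearrangement a x y with ≤-total x y
... | inj₁ x≤y = rearrangement-≤ a x≤y
... | inj₂ y≤x = subst₂ _≤_ (+-comm (y ^ a * x) (x ^ a * y)) (+-comm (y ^ suc a) (x ^ suc a))
                        (rearrangement-≤ a y≤x)

chebyshev : ∀ k a (x : Fin k → ℕ) → ∑[ i < k ] (x i ^ a) * sum x ≤ k * ∑[ i < k ] (x i ^ suc a)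
chebyshev k a x = *-cancelˡ-≤ 2 (begin
  2 * (A * B)
    ≡⟨ twice (A * B) ⟩
  A * B + A * B
    ≡⟨ cong₂ _+_ (sym (∑∑-product xᵃ x)) (trans (sym (∑∑-product xᵃ x)) (∑-comm (λ i j → x i ^ a * x j))) ⟩
  ∑[ i < k ] ∑[ j < k ] (x i ^ a * x j) + ∑[ i < k ] ∑[ j < k ] (x j ^ a * x i)
    ≡⟨ sym (∑∑-distrib-+ (λ i j → x i ^ a * x j) (λ i j → x j ^ a * x i)) ⟩
  ∑[ i < k ] ∑[ j < k ] (x i ^ a * x j + x j ^ a * x i)
    ≤⟨ sum-mono-≤ (λ i → sum-mono-≤ (λ j → rearrangement a (x i) (x j))) ⟩
  ∑[ i < k ] ∑[ j < k ] (x i ^ suc a + x j ^ suc a)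
    ≡⟨ ∑∑-distrib-+ (λ i j → x i ^ suc a) (λ i j → x j ^ suc a) ⟩
  ∑[ i < k ] ∑[ j < k ] (x i ^ suc a) + ∑[ i < k ] C
    ≡⟨ cong₂ _+_ (trans (sum-cong-≗ (λ i → sum-const k (x i ^ suc a))) (sym (*-distribˡ-sum k (λ i → x i ^ suc a))))
                 (sum-const k C) ⟩
  k * C + k * C
    ≡⟨ twice (k * C) ⟨
  2 * (k * C) ∎)
  where
  open ≤-Reasoning
  xᵃ : Fin k → ℕ
  xᵃ i = x i ^ a
  A B C : ℕ
  A = sum xᵃ
  B = sum x
  C = ∑[ i < k ] (x i ^ suc a)
  twice : ∀ y → 2 * y ≡ y + y
  twice = solve-∀

power-mean : ∀ k s (x : Fin k → ℕ) → sum x ^ suc s ≤ k ^ s * ∑[ i < k ] (x i ^ suc s)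
power-mean k zero    x = ≤-reflexive (trans (*-identityʳ (sum x))
  (sym (trans (+-identityʳ _) (sum-cong-≗ (λ i → *-identityʳ (x i))))))
power-mean k (suc s) x = begin
  sum x * sum x ^ suc s  ≤⟨ *-monoʳ-≤ (sum x) (power-mean k s x) ⟩
  sum x * (k ^ s * P)    ≡⟨ identity (sum x) (k ^ s) P ⟩
  k ^ s * (P * sum x)    ≤⟨ *-monoʳ-≤ (k ^ s) (chebyshev k (suc s) x) ⟩
  k ^ s * (k * Q)        ≡⟨ identity′ (k ^ s) k Q ⟩
  k ^ suc s * Q          ∎
  where
  open ≤-Reasoning
  P = ∑[ i < k ] (x i ^ suc s)
  Q = ∑[ i < k ] (x i ^ suc (suc s))
  identity : ∀ a b c → a * (b * c) ≡ b * (c * a)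
  identity = solve-∀
  identity′ : ∀ a b c → a * (b * c) ≡ b * a * c
  identity′ = solve-∀

power-mean₂ : ∀ k l s (x : Fin k → Fin l → ℕ) →
              (∑[ i < k ] ∑[ j < l ] x i j) ^ suc s ≤ k ^ s * (l ^ s * ∑[ i < k ] ∑[ j < l ] (x i j ^ suc s))
power-mean₂ k l s x = begin
  (∑[ i < k ] ∑[ j < l ] x i j) ^ suc s
    ≤⟨ power-mean k s (λ i → sum (x i)) ⟩
  k ^ s * ∑[ i < k ] (sum (x i) ^ suc s)
    ≤⟨ *-monoʳ-≤ (k ^ s) (sum-mono-≤ (λ i → power-mean l s (x i))) ⟩
  k ^ s * ∑[ i < k ] (l ^ s * ∑[ j < l ] (x i j ^ suc s))
    ≡⟨ cong (k ^ s *_) (*-distribˡ-sum (l ^ s) (λ i → ∑[ j < l ] (x i j ^ suc s))) ⟨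
  k ^ s * (l ^ s * ∑[ i < k ] ∑[ j < l ] (x i j ^ suc s)) ∎
  where open ≤-Reasoning

^-distribʳ-* : ∀ x y t → (x * y) ^ t ≡ x ^ t * y ^ t
^-distribʳ-* x y zero    = refl
^-distribʳ-* x y (suc t) = trans (cong (x * y *_) (^-distribʳ-* x y t)) (identity x y (x ^ t) (y ^ t))
  where
  identity : ∀ x y a b → x * y * (a * b) ≡ x * a * (y * b)
  identity = solve-∀

square-^ : ∀ x t → (x * x) ^ t ≡ x ^ (t + t)
square-^ x t = trans (^-distribʳ-* x x t) (sym (^-distribˡ-+-* x t t))

^-cancelˡ : ∀ d t {y} → d * d ^ suc t ≤ d * y → d ^ suc t ≤ y
^-cancelˡ zero    t h = z≤n
^-cancelˡ (suc d) t h = *-cancelˡ-≤ (suc d) h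

suc≤4^ : ∀ t → suc t ≤ 4 ^ t
suc≤4^ zero    = ≤-refl
suc≤4^ (suc t) = begin
  1 + suc t          ≤⟨ +-mono-≤ (m^n>0 4 t) (suc≤4^ t) ⟩
  4 ^ t + 4 ^ t      ≤⟨ +-monoʳ-≤ (4 ^ t) (m≤m+n (4 ^ t) _) ⟩
  4 ^ suc t          ∎
  where open ≤-Reasoning

4^-bound : ∀ t → 2 * 4 ^ t + (3 + t) ≤ 4 ^ (2 + (t + t))
4^-bound t = begin
  2 * 4 ^ t + (2 + suc t)        ≤⟨ +-monoʳ-≤ (2 * 4 ^ t) (+-mono-≤ (*-monoʳ-≤ 2 (m^n>0 4 t)) (suc≤4^ t)) ⟩
  2 * 4 ^ t + (2 * 4 ^ t + 4 ^ t) ≡⟨ identity (4 ^ t) ⟩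
  5 * 4 ^ t                      ≤⟨ *-monoˡ-≤ (4 ^ t) (m≤m+n 5 11) ⟩
  16 * 4 ^ t                     ≡⟨ identity′ (4 ^ t) ⟩
  4 ^ (2 + t)                    ≤⟨ ^-monoʳ-≤ 4 (+-monoʳ-≤ 2 (m≤m+n t t)) ⟩
  4 ^ (2 + (t + t))              ∎
  where
  open ≤-Reasoning
  identity : ∀ y → 2 * y + (2 * y + y) ≡ 5 * y
  identity = solve-∀
  identity′ : ∀ y → 16 * y ≡ 4 * (4 * y)
  identity′ = solve-∀

4mr^-split : ∀ m r k → (4 * m * r) ^ k ≡ 4 ^ k * (m * r) ^ k
4mr^-split m r k = trans (cong (_^ k) (*-assoc 4 m r)) (^-distribʳ-* 4 (m * r) k)

increment-coefficients : ∀ t X v → 2 * 4 ^ t * X + (4 ^ t + (3 + t)) * v ≤ 4 ^ (2 + (t + t)) * (X + v)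
increment-coefficients t X v = begin
  2 * c * X + (c + P) * v                        ≤⟨ m≤m+n _ (P * X + c * v) ⟩
  2 * c * X + (c + P) * v + (P * X + c * v)      ≡⟨ factor c P X v ⟩
  (2 * c + P) * (X + v)                          ≤⟨ *-monoˡ-≤ (X + v) (4^-bound t) ⟩
  4 ^ (2 + (t + t)) * (X + v)                    ∎
  where
  open ≤-Reasoning
  c = 4 ^ t
  P = 3 + t
  factor : ∀ c P X v → 2 * c * X + (c + P) * v + (P * X + c * v) ≡ (2 * c + P) * (X + v)
  factor = solve-∀

increment-arithmetic : ∀ m r t d X u → 1 ≤ r →
  (m * r) ^ (2 + t) * ((4 * m * r) ^ t * (d * X + d * (X + d * u))) + (3 + t) * (d * d * m ^ (2 + (t + t))) * u
    ≤ d * ((4 * m * r) ^ (2 + (t + t)) * (X + d * u))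
increment-arithmetic m r t d X u r≥1 = begin
  Z ^ s * ((4 * m * r) ^ t * Y) + P * (d * d * m ^ t′) * u
    ≤⟨ +-monoʳ-≤ _ (*-monoˡ-≤ u (*-monoʳ-≤ P (*-monoʳ-≤ (d * d) (^-monoˡ-≤ t′ m≤Z)))) ⟩
  Z ^ s * ((4 * m * r) ^ t * Y) + P * (d * d * Z ^ t′) * u
    ≡⟨ cong₂ (λ K N → Z ^ s * (K * Y) + P * (d * d * N) * u) (4mr^-split m r t) (^-distribˡ-+-* Z s t) ⟩
  Z ^ s * (4 ^ t * Z ^ t * Y) + P * (d * d * (Z ^ s * Z ^ t)) * u
    ≡⟨ collect (Z ^ s) (Z ^ t) (4 ^ t) P d X u ⟩
  d * (Z ^ s * Z ^ t) * (2 * 4 ^ t * X + (4 ^ t + P) * (d * u))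
    ≤⟨ *-monoʳ-≤ (d * (Z ^ s * Z ^ t)) (increment-coefficients t X (d * u)) ⟩
  d * (Z ^ s * Z ^ t) * (4 ^ t′ * (X + d * u))
    ≡⟨ regroup d (Z ^ s * Z ^ t) (4 ^ t′) (X + d * u) ⟩
  d * (4 ^ t′ * (Z ^ s * Z ^ t) * (X + d * u))
    ≡⟨ cong (λ K → d * (K * (X + d * u))) (trans (4mr^-split m r t′) (cong (4 ^ t′ *_) (^-distribˡ-+-* Z s t))) ⟨
  d * ((4 * m * r) ^ t′ * (X + d * u)) ∎
  where
  open ≤-Reasoning
  Z  = m * r
  s  = 2 + t
  P  = 3 + t
  t′ = 2 + (t + t)
  Y  = d * X + d * (X + d * u)
  m≤Z : m ≤ Z
  m≤Z = subst (_≤ Z) (*-identityʳ m) (*-monoʳ-≤ m r≥1)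
  collect : ∀ A B c P d X u → A * (c * B * (d * X + d * (X + d * u))) + P * (d * d * (A * B)) * u
                              ≡ d * (A * B) * (2 * c * X + (c + P) * (d * u))
  collect = solve-∀
  regroup : ∀ d N F y → d * N * (F * y) ≡ d * (F * N * y)
  regroup = solve-∀

q : ℕ → ℕ
q zero    = 0
q (suc k) = 2 + (q k + q k)

q+2≡2^ : ∀ k → q k + 2 ≡ 2 ^ suc k
q+2≡2^ zero    = refl
q+2≡2^ (suc k) = trans (identity (q k)) (cong (2 *_) (q+2≡2^ k))
  where
  identity : ∀ x → 2 + (x + x) + 2 ≡ 2 * (x + 2)
  identity = solve-∀

q≤2^[k+3] : ∀ k → q k ≤ 2 ^ (k + 3)
q≤2^[k+3] k = begin
  q k          ≤⟨ m≤m+n (q k) 2 ⟩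
  q k + 2      ≡⟨ q+2≡2^ k ⟩
  2 ^ suc k    ≤⟨ ^-monoʳ-≤ 2 (subst (suc k ≤_) (+-comm 3 k) (m≤n+m (suc k) 2)) ⟩
  2 ^ (k + 3)  ∎
  where open ≤-Reasoning

raise-exponent : ∀ {x M Y Q K} → Q ≤ K → x ≤ M → x ^ (3 + Q) ≤ M ^ Q * Y → x ^ (3 + K) ≤ Y * M ^ K
raise-exponent {x} {M} {Y} {Q} Q≤K x≤M h with t , refl ← m≤n⇒∃[o]m+o≡n Q≤K = begin
  x ^ (3 + (Q + t))       ≡⟨ cong (x ^_) (+-assoc 3 Q t) ⟨
  x ^ (3 + Q + t)         ≡⟨ ^-distribˡ-+-* x (3 + Q) t ⟩
  x ^ (3 + Q) * x ^ t     ≤⟨ *-mono-≤ h (^-monoˡ-≤ t x≤M) ⟩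
  M ^ Q * Y * M ^ t       ≡⟨ identity (M ^ Q) Y (M ^ t) ⟩
  Y * (M ^ Q * M ^ t)     ≡⟨ cong (Y *_) (^-distribˡ-+-* M Q t) ⟨
  Y * M ^ (Q + t)         ∎
  where
  open ≤-Reasoning
  identity : ∀ a y b → a * y * b ≡ y * (a * b)
  identity = solve-∀

rows-injective⇒≤ : ∀ {n m} (f : Fin n → Fin n → Fin m) →
                   (∀ b {c c′} → f b c ≡ f b c′ → c ≡ c′) → n ≤ m
rows-injective⇒≤ {zero}  f injective = z≤n
rows-injective⇒≤ {suc n} f injective = Fin.injective⇒≤ (injective zero)

-- apex b c and colour b c are the apex and the colour of the decomposition triangle on the edge bc.
module ApexLabelling {n m r : ℕ}
  (apex : Fin n → Fin n → Fin m) (colour : Fin n → Fin n → Fin r)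
  (apex-injectiveʳ : ∀ b {c c′} → apex b c ≡ apex b c′ → c ≡ c′)
  (apex-injectiveˡ : ∀ c {b b′} → apex b c ≡ apex b′ c → b ≡ b′)
  where

  Palette : Set
  Palette = Fin r → Bool

  -- ab and ac lie on decomposition triangles with apex a whose bases bc′ and b′c have the colour of bc,
  -- so abc is a monochromatic triangle.
  forcedMono : Fin m → Fin n → Fin n → Bool
  forcedMono a b c = any (λ c′ → apex b c′ == a ∧ colour b c′ == colour b c)
                   ∧ any (λ b′ → apex b′ c == a ∧ colour b′ c == colour b c)

  monos : (B C : Fin n → Bool) → ℕ
  monos B C = ∑[ a < m ] ∑[ b < n ] ∑[ c < n ] 𝟙 (B b ∧ C c ∧ forcedMono a b c)

  cellIn cellOff : Palette → (B C : Fin n → Bool) → Fin n → Fin n → Bool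
  cellIn  S B C b c = B b ∧ C c ∧ S (colour b c)
  cellOff S B C b c = B b ∧ C c ∧ not (S (colour b c))

  cellsIn cellsOff : Palette → (B C : Fin n → Bool) → ℕ
  cellsIn  S B C = ∑[ b < n ] ∑[ c < n ] 𝟙 (cellIn S B C b c)
  cellsOff S B C = ∑[ b < n ] ∑[ c < n ] 𝟙 (cellOff S B C b c)

  module Classes (S : Palette) (B C : Fin n → Bool) where

    classCell : Fin m → Fin r → Fin n → Fin n → Bool
    classCell a χ b c = cellIn S B C b c ∧ apex b c == a ∧ colour b c == χ

    classSize : Fin m → Fin r → ℕ
    classSize a χ = ∑[ b < n ] ∑[ c < n ] 𝟙 (classCell a χ b c)

    classRows classCols : Fin m → Fin r → Fin n → Bool
    classRows a χ b = any (λ c → classCell a χ b c)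
    classCols a χ c = any (λ b → classCell a χ b c)

    classMonos classOff : Fin m → Fin r → ℕ
    classMonos a χ = monos (classRows a χ) (classCols a χ)
    classOff   a χ = cellsOff (S ∖ χ) (classRows a χ) (classCols a χ)

    module _ {a χ b c} (cell : T (classCell a χ b c)) where

      private
        inCell = T-∧-elim (cellIn S B C b c) cell
        labels = T-∧-elim (apex b c == a) (proj₂ inCell)
        inRow  = T-∧-elim (B b) (proj₁ inCell)
        inCol  = T-∧-elim (C c) (proj₂ inRow)

      classCell⇒row : T (B b)
      classCell⇒row = proj₁ inRow

      classCell⇒col : T (C c)
      classCell⇒col = proj₁ inCol

      classCell⇒apex : apex b c ≡ a
      classCell⇒apex = ==-sound (proj₁ labels)

      classCell⇒colour : colour b c ≡ χ
      classCell⇒colour = ==-sound (proj₂ labels)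

      classCell⇒palette : T (S χ)
      classCell⇒palette = subst (λ κ → T (S κ)) classCell⇒colour (proj₂ inCol)

    ∣classRows∣≡classSize : ∀ a χ → ∣ classRows a χ ∣ ≡ classSize a χ
    ∣classRows∣≡classSize a χ = sym (sum-cong-≗ λ b →
      ∣∣≡𝟙-any (classCell a χ b) (λ p q → apex-injectiveʳ b (trans (classCell⇒apex p) (sym (classCell⇒apex q)))))

    ∣classCols∣≡classSize : ∀ a χ → ∣ classCols a χ ∣ ≡ classSize a χ
    ∣classCols∣≡classSize a χ = sym (trans (∑-comm (λ b c → 𝟙 (classCell a χ b c))) (sum-cong-≗ λ c →
      ∣∣≡𝟙-any (λ b → classCell a χ b c)
               (λ p q → apex-injectiveˡ c (trans (classCell⇒apex p) (sym (classCell⇒apex q))))))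

    classRows⊆B : ∀ {a χ b} → T (classRows a χ b) → T (B b)
    classRows⊆B {a} {χ} {b} h = classCell⇒row (proj₂ (any-elim (classCell a χ b) h))

    classCols⊆C : ∀ {a χ c} → T (classCols a χ c) → T (C c)
    classCols⊆C {a} {χ} {c} h = classCell⇒col (proj₂ (any-elim (λ b → classCell a χ b c) h))

    classSize≤∣B∣ : ∀ a χ → classSize a χ ≤ ∣ B ∣
    classSize≤∣B∣ a χ =
      subst (_≤ ∣ B ∣) (∣classRows∣≡classSize a χ) (∣∣-mono {P = classRows a χ} (λ _ → classRows⊆B))

    classCell-partition : ∀ b c → ∑[ a < m ] ∑[ χ < r ] 𝟙 (classCell a χ b c) ≡ 𝟙 (cellIn S B C b c)
    classCell-partition b c = begin
      ∑[ a < m ] ∑[ χ < r ] 𝟙 (classCell a χ b c)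
        ≡⟨ sum-cong-≗ (λ a → sum-cong-≗ (λ χ → trans (𝟙-∧₃ e (apex b c == a) (colour b c == χ))
                                                     (rotate (𝟙 e) (𝟙 (apex b c == a)) (𝟙 (colour b c == χ))))) ⟩
      ∑[ a < m ] ∑[ χ < r ] (𝟙 (apex b c == a) * (𝟙 (colour b c == χ) * 𝟙 e))
        ≡⟨ sum-cong-≗ (λ a → *-distribˡ-sum (𝟙 (apex b c == a)) (λ χ → 𝟙 (colour b c == χ) * 𝟙 e)) ⟨
      ∑[ a < m ] (𝟙 (apex b c == a) * ∑[ χ < r ] (𝟙 (colour b c == χ) * 𝟙 e))
        ≡⟨ sum-cong-≗ (λ a → cong (𝟙 (apex b c == a) *_) (∑-select (colour b c) (λ _ → 𝟙 e))) ⟩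
      ∑[ a < m ] (𝟙 (apex b c == a) * 𝟙 e)
        ≡⟨ ∑-select (apex b c) (λ _ → 𝟙 e) ⟩
      𝟙 e ∎
      where
      open ≡-Reasoning
      e = cellIn S B C b c
      rotate : ∀ x y z → x * y * z ≡ y * (z * x)
      rotate = solve-∀

    ∑∑classSize≡cellsIn : ∑[ a < m ] ∑[ χ < r ] classSize a χ ≡ cellsIn S B C
    ∑∑classSize≡cellsIn = trans (∑∑-comm-∑∑ (λ a χ b c → 𝟙 (classCell a χ b c)))
                                (sum-cong-≗ λ b → sum-cong-≗ λ c → classCell-partition b c)

    ∑∑classRows≤∣C∣ : ∀ b → ∑[ a < m ] ∑[ χ < r ] 𝟙 (classRows a χ b) ≤ ∣ C ∣
    ∑∑classRows≤∣C∣ b = begin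
      ∑[ a < m ] ∑[ χ < r ] 𝟙 (classRows a χ b)
        ≤⟨ sum-mono-≤ (λ a → sum-mono-≤ (λ χ → 𝟙-any≤∣∣ (classCell a χ b))) ⟩
      ∑[ a < m ] ∑[ χ < r ] ∑[ c < n ] 𝟙 (classCell a χ b c)
        ≡⟨ sum-cong-≗ (λ a → ∑-comm (λ χ c → 𝟙 (classCell a χ b c))) ⟩
      ∑[ a < m ] ∑[ c < n ] ∑[ χ < r ] 𝟙 (classCell a χ b c)
        ≡⟨ ∑-comm (λ a c → ∑[ χ < r ] 𝟙 (classCell a χ b c)) ⟩
      ∑[ c < n ] ∑[ a < m ] ∑[ χ < r ] 𝟙 (classCell a χ b c)
        ≡⟨ sum-cong-≗ (classCell-partition b) ⟩
      ∑[ c < n ] 𝟙 (cellIn S B C b c)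
        ≤⟨ ∣∣-mono {P = cellIn S B C b} (λ c h → proj₁ (T-∧-elim (C c) (proj₂ (T-∧-elim (B b) h)))) ⟩
      ∣ C ∣ ∎
      where open ≤-Reasoning

    ∑∑-weighted-classRows : ∀ (H : Fin n → Fin n → ℕ) →
      ∑[ a < m ] ∑[ χ < r ] ∑[ b < n ] ∑[ c < n ] (𝟙 (classRows a χ b) * H b c)
        ≤ ∣ C ∣ * ∑[ b < n ] ∑[ c < n ] H b c
    ∑∑-weighted-classRows H = begin
      ∑[ a < m ] ∑[ χ < r ] ∑[ b < n ] ∑[ c < n ] (𝟙 (classRows a χ b) * H b c)
        ≡⟨ ∑∑-comm-∑∑ (λ a χ b c → 𝟙 (classRows a χ b) * H b c) ⟩
      ∑[ b < n ] ∑[ c < n ] ∑[ a < m ] ∑[ χ < r ] (𝟙 (classRows a χ b) * H b c)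
        ≡⟨ sum-cong-≗ (λ b → sum-cong-≗ (λ c → *-distribʳ-∑∑ (H b c) (λ a χ → 𝟙 (classRows a χ b)))) ⟨
      ∑[ b < n ] ∑[ c < n ] ((∑[ a < m ] ∑[ χ < r ] 𝟙 (classRows a χ b)) * H b c)
        ≤⟨ sum-mono-≤ (λ b → sum-mono-≤ (λ c → *-monoˡ-≤ (H b c) (∑∑classRows≤∣C∣ b))) ⟩
      ∑[ b < n ] ∑[ c < n ] (∣ C ∣ * H b c)
        ≡⟨ *-distribˡ-∑∑ ∣ C ∣ H ⟨
      ∣ C ∣ * ∑[ b < n ] ∑[ c < n ] H b c ∎
      where open ≤-Reasoning

    ∑∑classMonos≤ : ∑[ a < m ] ∑[ χ < r ] classMonos a χ ≤ ∣ C ∣ * monos B C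
    ∑∑classMonos≤ = begin
      ∑[ a < m ] ∑[ χ < r ] ∑[ a′ < m ] ∑[ b < n ] ∑[ c < n ] 𝟙 (classRows a χ b ∧ classCols a χ c ∧ forcedMono a′ b c)
        ≤⟨ sum-mono-≤ (λ a → sum-mono-≤ λ χ → sum-mono-≤ λ a′ → sum-mono-≤ λ b → sum-mono-≤ λ c →
             𝟙-restrict (classRows a χ b) (classCols a χ c) (forcedMono a′ b c) classRows⊆B classCols⊆C) ⟩
      ∑[ a < m ] ∑[ χ < r ] ∑[ a′ < m ] F a χ a′
        ≡⟨ sum-cong-≗ (λ a → ∑-comm (F a)) ⟩
      ∑[ a < m ] ∑[ a′ < m ] ∑[ χ < r ] F a χ a′
        ≡⟨ ∑-comm (λ a a′ → ∑[ χ < r ] F a χ a′) ⟩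
      ∑[ a′ < m ] ∑[ a < m ] ∑[ χ < r ] F a χ a′
        ≤⟨ sum-mono-≤ (λ a′ → ∑∑-weighted-classRows (λ b c → 𝟙 (B b ∧ C c ∧ forcedMono a′ b c))) ⟩
      ∑[ a′ < m ] (∣ C ∣ * ∑[ b < n ] ∑[ c < n ] 𝟙 (B b ∧ C c ∧ forcedMono a′ b c))
        ≡⟨ *-distribˡ-sum ∣ C ∣ (λ a′ → ∑[ b < n ] ∑[ c < n ] 𝟙 (B b ∧ C c ∧ forcedMono a′ b c)) ⟨
      ∣ C ∣ * monos B C ∎
      where
      open ≤-Reasoning
      F : Fin m → Fin r → Fin m → ℕ
      F a χ a′ = ∑[ b < n ] ∑[ c < n ] (𝟙 (classRows a χ b) * 𝟙 (B b ∧ C c ∧ forcedMono a′ b c))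

    classRows∧classCols⇒forcedMono : ∀ a b c → T (classRows a (colour b c) b ∧ classCols a (colour b c) c) →
                                     T (B b ∧ C c ∧ forcedMono a b c)
    classRows∧classCols⇒forcedMono a b c h
      with rows , cols ← T-∧-elim (classRows a (colour b c) b) h
      with c′ , cell  ← any-elim (classCell a (colour b c) b) rows
         | b′ , cell′ ← any-elim (λ b′ → classCell a (colour b c) b′ c) cols
      = T-∧-intro (classCell⇒row cell) (T-∧-intro (classCell⇒col cell′) (T-∧-intro
          (any-intro _ c′ (T-∧-intro (≡⇒T== (classCell⇒apex cell)) (≡⇒T== (classCell⇒colour cell))))
          (any-intro _ b′ (T-∧-intro (≡⇒T== (classCell⇒apex cell′)) (≡⇒T== (classCell⇒colour cell′))))))

    sameColourCell : Fin m → Fin r → Fin n → Fin n → Bool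
    sameColourCell a χ b c = classRows a χ b ∧ classCols a χ c ∧ colour b c == χ

    ∑sameColourCell≤forcedMono : ∀ a b c →
      ∑[ χ < r ] 𝟙 (sameColourCell a χ b c) ≤ 𝟙 (B b ∧ C c ∧ forcedMono a b c)
    ∑sameColourCell≤forcedMono a b c = begin
      ∑[ χ < r ] 𝟙 (sameColourCell a χ b c)
        ≡⟨ sum-cong-≗ (λ χ → trans (𝟙-∧₃ (classRows a χ b) (classCols a χ c) (colour b c == χ))
                                   (rotate (𝟙 (classRows a χ b)) (𝟙 (classCols a χ c)) (𝟙 (colour b c == χ)))) ⟩
      ∑[ χ < r ] (𝟙 (colour b c == χ) * (𝟙 (classRows a χ b) * 𝟙 (classCols a χ c)))
        ≡⟨ ∑-select (colour b c) (λ χ → 𝟙 (classRows a χ b) * 𝟙 (classCols a χ c)) ⟩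
      𝟙 (classRows a κ b) * 𝟙 (classCols a κ c)
        ≡⟨ 𝟙-∧ (classRows a κ b) (classCols a κ c) ⟨
      𝟙 (classRows a κ b ∧ classCols a κ c)
        ≤⟨ 𝟙-mono (classRows∧classCols⇒forcedMono a b c) ⟩
      𝟙 (B b ∧ C c ∧ forcedMono a b c) ∎
      where
      open ≤-Reasoning
      κ = colour b c
      rotate : ∀ x y z → x * y * z ≡ z * (x * y)
      rotate = solve-∀

    ∑∑sameColourCells≤monos :
      ∑[ a < m ] ∑[ χ < r ] ∑[ b < n ] ∑[ c < n ] 𝟙 (sameColourCell a χ b c) ≤ monos B C
    ∑∑sameColourCells≤monos = begin
      ∑[ a < m ] ∑[ χ < r ] ∑[ b < n ] ∑[ c < n ] 𝟙 (sameColourCell a χ b c)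
        ≡⟨ sum-cong-≗ (λ a → trans (∑-comm (λ χ b → ∑[ c < n ] 𝟙 (sameColourCell a χ b c)))
                                   (sum-cong-≗ (λ b → ∑-comm (λ χ c → 𝟙 (sameColourCell a χ b c))))) ⟩
      ∑[ a < m ] ∑[ b < n ] ∑[ c < n ] ∑[ χ < r ] 𝟙 (sameColourCell a χ b c)
        ≤⟨ sum-mono-≤ (λ a → sum-mono-≤ λ b → sum-mono-≤ λ c → ∑sameColourCell≤forcedMono a b c) ⟩
      monos B C ∎
      where open ≤-Reasoning

    -- An edge of the box of class (a, χ) that is off the palette S ∖ χ has colour χ or is off S.
    ∑∑classOff≤ : ∑[ a < m ] ∑[ χ < r ] classOff a χ ≤ monos B C + ∣ C ∣ * cellsOff S B C
    ∑∑classOff≤ = begin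
      ∑[ a < m ] ∑[ χ < r ] ∑[ b < n ] ∑[ c < n ] 𝟙 (cellOff (S ∖ χ) (classRows a χ) (classCols a χ) b c)
        ≤⟨ sum-mono-≤ (λ a → sum-mono-≤ λ χ → sum-mono-≤ λ b → sum-mono-≤ λ c →
             𝟙-cellOff-split (classRows a χ b) (classCols a χ c) (S (colour b c)) (colour b c == χ)
                             classRows⊆B classCols⊆C) ⟩
      ∑[ a < m ] ∑[ χ < r ] ∑[ b < n ] ∑[ c < n ] (𝟙 (sameColourCell a χ b c) + offPalette a χ b c)
        ≡⟨ trans (sum-cong-≗ λ a → sum-cong-≗ λ χ →
                   ∑∑-distrib-+ (λ b c → 𝟙 (sameColourCell a χ b c)) (offPalette a χ))
                 (∑∑-distrib-+ (λ a χ → ∑[ b < n ] ∑[ c < n ] 𝟙 (sameColourCell a χ b c))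
                               (λ a χ → ∑[ b < n ] ∑[ c < n ] offPalette a χ b c)) ⟩
      ∑[ a < m ] ∑[ χ < r ] ∑[ b < n ] ∑[ c < n ] 𝟙 (sameColourCell a χ b c)
        + ∑[ a < m ] ∑[ χ < r ] ∑[ b < n ] ∑[ c < n ] offPalette a χ b c
        ≤⟨ +-mono-≤ ∑∑sameColourCells≤monos (∑∑-weighted-classRows (λ b c → 𝟙 (cellOff S B C b c))) ⟩
      monos B C + ∣ C ∣ * cellsOff S B C ∎
      where
      open ≤-Reasoning
      offPalette : Fin m → Fin r → Fin n → Fin n → ℕ
      offPalette a χ b c = 𝟙 (classRows a χ b) * 𝟙 (cellOff S B C b c)

    cellsIn+cellsOff : cellsIn S B C + cellsOff S B C ≡ ∣ B ∣ * ∣ C ∣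
    cellsIn+cellsOff = begin
      cellsIn S B C + cellsOff S B C
        ≡⟨ ∑∑-distrib-+ (λ b c → 𝟙 (cellIn S B C b c)) (λ b c → 𝟙 (cellOff S B C b c)) ⟨
      ∑[ b < n ] ∑[ c < n ] (𝟙 (cellIn S B C b c) + 𝟙 (cellOff S B C b c))
        ≡⟨ sum-cong-≗ (λ b → sum-cong-≗ λ c → 𝟙-split (B b) (C c) (S (colour b c))) ⟩
      ∑[ b < n ] ∑[ c < n ] (𝟙 (B b) * 𝟙 (C c))
        ≡⟨ ∑∑-product (λ b → 𝟙 (B b)) (λ c → 𝟙 (C c)) ⟩
      ∣ B ∣ * ∣ C ∣ ∎
      where open ≡-Reasoning

    classSize≡0 : ∀ a {χ} → ¬ T (S χ) → classSize a χ ≡ 0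
    classSize≡0 a {χ} ¬Sχ =
      ∑∑-zero (λ b c → 𝟙 (classCell a χ b c)) (λ b c → 𝟙-false (λ cell → ¬Sχ (classCell⇒palette cell)))

  n≤m : n ≤ m
  n≤m = rows-injective⇒≤ apex apex-injectiveʳ

  Claim : ℕ → Set
  Claim k = ∀ S B C → ∣ S ∣ ≤ k → ∣ B ∣ ≡ ∣ C ∣ →
            ∣ B ∣ ^ (3 + q k) ≤ (4 * m * r) ^ q k * (monos B C + ∣ B ∣ * cellsOff S B C)

  claim-zero : Claim 0
  claim-zero S B C ∣S∣≤0 ∣B∣≡∣C∣ = begin
    d ^ 3                               ≡⟨ cong (λ y → d * (d * y)) (*-identityʳ d) ⟩
    d * (d * d)                         ≡⟨ cong (λ y → d * (d * y)) ∣B∣≡∣C∣ ⟩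
    d * (d * ∣ C ∣)                     ≡⟨ cong (d *_) cellsIn+cellsOff ⟨
    d * (cellsIn S B C + cellsOff S B C) ≡⟨ cong (λ y → d * (y + cellsOff S B C)) cellsIn≡0 ⟩
    d * cellsOff S B C                  ≤⟨ m≤n+m _ (monos B C) ⟩
    monos B C + d * cellsOff S B C      ≡⟨ *-identityˡ _ ⟨
    1 * (monos B C + d * cellsOff S B C) ∎
    where
    open ≤-Reasoning
    open Classes S B C
    d = ∣ B ∣
    cellsIn≡0 : cellsIn S B C ≡ 0
    cellsIn≡0 = trans (sym ∑∑classSize≡cellsIn)
                      (∑∑-zero classSize (λ a χ → classSize≡0 a (λ Sχ → case ≤-trans (1≤∣∣ S Sχ) ∣S∣≤0 of λ ())))

  module Increment {k} (r≥1 : 1 ≤ r) (claim : Claim k) (S : Palette) (B C : Fin n → Bool)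
                   (∣S∣≤1+k : ∣ S ∣ ≤ suc k) (∣B∣≡∣C∣ : ∣ B ∣ ≡ ∣ C ∣) where

    open Classes S B C

    d X u e t s P K : ℕ
    d = ∣ B ∣
    X = monos B C
    u = cellsOff S B C
    e = cellsIn S B C
    t = q k
    s = 2 + t
    P = 3 + t
    K = (4 * m * r) ^ t

    d*d≡e+u : d * d ≡ e + u
    d*d≡e+u = trans (cong (d *_) ∣B∣≡∣C∣) (sym cellsIn+cellsOff)

    class-bound : ∀ a χ → classSize a χ ^ P ≤ K * (classMonos a χ + classSize a χ * classOff a χ)
    class-bound a χ with T? (S χ)
    ... | no ¬Sχ rewrite classSize≡0 a ¬Sχ = z≤n
    ... | yes Sχ = subst (λ z → z ^ P ≤ K * (classMonos a χ + z * classOff a χ))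
                         (∣classRows∣≡classSize a χ)
                         (claim (S ∖ χ) (classRows a χ) (classCols a χ) ∣S∖χ∣≤k
                                (trans (∣classRows∣≡classSize a χ) (sym (∣classCols∣≡classSize a χ))))
      where
      ∣S∖χ∣≤k : ∣ S ∖ χ ∣ ≤ k
      ∣S∖χ∣≤k = s≤s⁻¹ (subst (_≤ suc k) (sym (∣∖∣ S Sχ)) ∣S∣≤1+k)

    ∑∑class-bound : ∑[ a < m ] ∑[ χ < r ] (classSize a χ ^ P) ≤ K * (d * X + d * (X + d * u))
    ∑∑class-bound = begin
      ∑[ a < m ] ∑[ χ < r ] (classSize a χ ^ P)
        ≤⟨ sum-mono-≤ (λ a → sum-mono-≤ λ χ → ≤-trans (class-bound a χ)
             (*-monoʳ-≤ K (+-monoʳ-≤ (classMonos a χ) (*-monoˡ-≤ (classOff a χ) (classSize≤∣B∣ a χ))))) ⟩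
      ∑[ a < m ] ∑[ χ < r ] (K * (classMonos a χ + d * classOff a χ))
        ≡⟨ *-distribˡ-∑∑ K (λ a χ → classMonos a χ + d * classOff a χ) ⟨
      K * ∑[ a < m ] ∑[ χ < r ] (classMonos a χ + d * classOff a χ)
        ≡⟨ cong (K *_) (trans (∑∑-distrib-+ classMonos (λ a χ → d * classOff a χ))
                              (cong (∑[ a < m ] ∑[ χ < r ] classMonos a χ +_) (sym (*-distribˡ-∑∑ d classOff)))) ⟩
      K * (∑[ a < m ] ∑[ χ < r ] classMonos a χ + d * ∑[ a < m ] ∑[ χ < r ] classOff a χ)
        ≤⟨ *-monoʳ-≤ K (+-mono-≤ ∑∑classMonos≤ (*-monoʳ-≤ d ∑∑classOff≤)) ⟩
      K * (∣ C ∣ * X + d * (X + ∣ C ∣ * u))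
        ≡⟨ cong (λ c → K * (c * X + d * (X + c * u))) ∣B∣≡∣C∣ ⟨
      K * (d * X + d * (X + d * u)) ∎
      where open ≤-Reasoning

    covered-bound : e ^ P ≤ (m * r) ^ s * (K * (d * X + d * (X + d * u)))
    covered-bound = begin
      e ^ P                                       ≡⟨ cong (_^ P) ∑∑classSize≡cellsIn ⟨
      (∑[ a < m ] ∑[ χ < r ] classSize a χ) ^ P   ≤⟨ power-mean₂ m r s classSize ⟩
      m ^ s * (r ^ s * Σ)                         ≡⟨ *-assoc (m ^ s) (r ^ s) Σ ⟨
      m ^ s * r ^ s * Σ                           ≡⟨ cong (_* Σ) (^-distribʳ-* m r s) ⟨
      (m * r) ^ s * Σ                             ≤⟨ *-monoʳ-≤ ((m * r) ^ s) ∑∑class-bound ⟩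
      (m * r) ^ s * (K * (d * X + d * (X + d * u))) ∎
      where
      open ≤-Reasoning
      Σ = ∑[ a < m ] ∑[ χ < r ] (classSize a χ ^ P)

    uncovered-bound : (e + u) ^ s ≤ d * d * m ^ q (suc k)
    uncovered-bound = begin
      (e + u) ^ s                ≡⟨ cong (_^ s) d*d≡e+u ⟨
      d * d * (d * d) ^ suc t    ≤⟨ *-monoʳ-≤ (d * d) (^-monoˡ-≤ (suc t) (*-mono-≤ d≤m d≤m)) ⟩
      d * d * (m * m) ^ suc t    ≡⟨ cong (d * d *_) (trans (square-^ m (suc t)) (cong (m ^_) (cong suc (+-suc t t)))) ⟩
      d * d * m ^ q (suc k)      ∎
      where
      open ≤-Reasoning
      d≤m : d ≤ m
      d≤m = ≤-trans (∣∣≤ B) n≤m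

    exponent : d * d ^ (3 + q (suc k)) ≡ (d * d) ^ P
    exponent = trans (cong (d ^_) (double t)) (sym (square-^ d P))
      where
      double : ∀ t → 1 + (3 + (2 + (t + t))) ≡ (3 + t) + (3 + t)
      double = solve-∀

    increment : d ^ (3 + q (suc k)) ≤ (4 * m * r) ^ q (suc k) * (X + d * u)
    increment = ^-cancelˡ d (2 + q (suc k)) (begin
      d * d ^ (3 + q (suc k))          ≡⟨ exponent ⟩
      (d * d) ^ P                      ≡⟨ cong (_^ P) d*d≡e+u ⟩
      (e + u) ^ P                      ≤⟨ bernoulli s e u ⟩
      e ^ P + P * (e + u) ^ s * u      ≤⟨ +-mono-≤ covered-bound (*-monoˡ-≤ u (*-monoʳ-≤ P uncovered-bound)) ⟩
      (m * r) ^ s * (K * (d * X + d * (X + d * u))) + P * (d * d * m ^ q (suc k)) * u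
                                       ≤⟨ increment-arithmetic m r t d X u r≥1 ⟩
      d * ((4 * m * r) ^ q (suc k) * (X + d * u)) ∎)
      where open ≤-Reasoning

  claim : 1 ≤ r → ∀ k → Claim k
  claim r≥1 zero    = claim-zero
  claim r≥1 (suc k) S B C = Increment.increment r≥1 (claim r≥1 k) S B C

  allVertices : Fin n → Bool
  allVertices _ = true

  allColours : Fin r → Bool
  allColours _ = true

  monos-bound : 1 ≤ r → n ^ (3 + 2 ^ (r + 3)) ≤ monos allVertices allVertices * (4 * m * r) ^ (2 ^ (r + 3))
  monos-bound r≥1 = raise-exponent (q≤2^[k+3] r) n≤4mr (begin
    n ^ (3 + q r)                      ≡⟨ cong (_^ (3 + q r)) (∣all∣ n) ⟨
    ∣ allVertices ∣ ^ (3 + q r)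
      ≤⟨ claim r≥1 r allColours allVertices allVertices (≤-reflexive (∣all∣ r)) refl ⟩
    K * (X + ∣ allVertices ∣ * cellsOff allColours allVertices allVertices)
      ≡⟨ cong (λ y → K * (X + y)) (trans (cong (∣ allVertices ∣ *_) no-cells-off) (*-zeroʳ ∣ allVertices ∣)) ⟩
    K * (X + 0)                        ≡⟨ cong (K *_) (+-identityʳ X) ⟩
    K * X                              ∎)
    where
    open ≤-Reasoning
    K = (4 * m * r) ^ q r
    X = monos allVertices allVertices
    no-cells-off : cellsOff allColours allVertices allVertices ≡ 0
    no-cells-off = ∑∑-zero {n} {n} (λ _ _ → 0) (λ _ _ → refl)
    n≤4mr : n ≤ 4 * m * r
    n≤4mr = ≤-trans n≤m (≤-trans (m≤n*m m 4) (subst (_≤ 4 * m * r) (*-identityʳ (4 * m)) (*-monoʳ-≤ (4 * m) r≥1)))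

module TriangleDecomposition {r n m} (G : TriGraph m n r)
  (complete : ∀ b c → adj12 G b c ≡ true)
  (tri : Fin (n * n) → Triple m n)
  (tri-mono : ∀ i → IsMonoTriangle G (tri i))
  (tri-disjoint : ∀ i j → i ≢ j → ¬ ShareEdge (tri i) (tri j))
  (tri-covers : ∀ b c → ∃ λ i → (proj₁ (proj₂ (tri i)) ≡ b) × (proj₂ (proj₂ (tri i)) ≡ c))
  where

  index : Fin n → Fin n → Fin (n * n)
  index b c = proj₁ (tri-covers b c)

  apex : Fin n → Fin n → Fin m
  apex b c = proj₁ (tri (index b c))

  index-row : ∀ b c → proj₁ (proj₂ (tri (index b c))) ≡ b
  index-row b c = proj₁ (proj₂ (tri-covers b c))

  index-col : ∀ b c → proj₂ (proj₂ (tri (index b c))) ≡ c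
  index-col b c = proj₂ (proj₂ (tri-covers b c))

  apex-injectiveʳ : ∀ b {c c′} → apex b c ≡ apex b c′ → c ≡ c′
  apex-injectiveʳ b {c} {c′} same-apex with index b c ≟ index b c′
  ... | yes same = trans (sym (index-col b c)) (trans (cong (λ i → proj₂ (proj₂ (tri i))) same) (index-col b c′))
  ... | no  differ =
    ⊥-elim (tri-disjoint _ _ differ (inj₁ (same-apex , trans (index-row b c) (sym (index-row b c′)))))

  apex-injectiveˡ : ∀ c {b b′} → apex b c ≡ apex b′ c → b ≡ b′
  apex-injectiveˡ c {b} {b′} same-apex with index b c ≟ index b′ c
  ... | yes same = trans (sym (index-row b c)) (trans (cong (λ i → proj₁ (proj₂ (tri i))) same) (index-row b′ c))
  ... | no  differ =
    ⊥-elim (tri-disjoint _ _ differ (inj₂ (inj₁ (same-apex , trans (index-col b c) (sym (index-col b′ c))))))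

  open ApexLabelling apex (col12 G) apex-injectiveʳ apex-injectiveˡ public

  mono⇒edges : ∀ {a b c} → T (isMonoTriangle G a b c) →
               T (adj01 G a b) × T (adj02 G a c) × col01 G a b ≡ col12 G b c × col02 G a c ≡ col12 G b c
  mono⇒edges {a} {b} {c} h =
    let triangle , colours = T-∧-elim (isTriangle G a b c) h
        ab , ac-bc         = T-∧-elim (adj01 G a b) triangle
        ab≡ac , ab≡bc      = T-∧-elim ⌊ col01 G a b ≟ col02 G a c ⌋ colours
        ab≡ac              = toWitness ab≡ac
        ab≡bc              = toWitness ab≡bc
    in ab , proj₁ (T-∧-elim (adj02 G a c) ac-bc) , ab≡bc , trans (sym ab≡ac) ab≡bc

  edges⇒mono : ∀ {a b c} → T (adj01 G a b) → T (adj02 G a c) →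
               col01 G a b ≡ col12 G b c → col02 G a c ≡ col12 G b c →
               T (isMonoTriangle G a b c)
  edges⇒mono {a} {b} {c} ab ac ab≡bc ac≡bc =
    T-∧-intro (T-∧-intro ab (T-∧-intro ac (Equivalence.from T-≡ (complete b c))))
              (T-∧-intro (fromWitness {a? = col01 G a b ≟ col02 G a c} (trans ab≡bc (sym ac≡bc)))
                         (fromWitness {a? = col01 G a b ≟ col12 G b c} ab≡bc))

  apex-mono : ∀ b c → T (isMonoTriangle G (apex b c) b c)
  apex-mono b c = subst₂ (λ b′ c′ → T (isMonoTriangle G (apex b c) b′ c′)) (index-row b c) (index-col b c)
                         (Equivalence.from T-≡ (tri-mono (index b c)))

  edge-ab : ∀ {a b c} → apex b c ≡ a → T (adj01 G a b) × col01 G a b ≡ col12 G b c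
  edge-ab {b = b} {c} refl = let ab , _ , ab≡bc , _ = mono⇒edges (apex-mono b c) in ab , ab≡bc

  edge-ac : ∀ {a b c} → apex b c ≡ a → T (adj02 G a c) × col02 G a c ≡ col12 G b c
  edge-ac {b = b} {c} refl = let _ , ac , _ , ac≡bc = mono⇒edges (apex-mono b c) in ac , ac≡bc

  forcedMono⇒mono : ∀ a b c → T (forcedMono a b c) → T (isMonoTriangle G a b c)
  forcedMono⇒mono a b c h
    with row , col ← T-∧-elim (any (λ c′ → apex b c′ == a ∧ col12 G b c′ == col12 G b c)) h
    with c′ , via-c′ ← any-elim (λ c′ → apex b c′ == a ∧ col12 G b c′ == col12 G b c) row
       | b′ , via-b′ ← any-elim (λ b′ → apex b′ c == a ∧ col12 G b′ c == col12 G b c) col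
    with apex-c′ , colour-c′ ← T-∧-elim (apex b c′ == a) via-c′
       | apex-b′ , colour-b′ ← T-∧-elim (apex b′ c == a) via-b′
    with ab , ab≡bc′ ← edge-ab (==-sound apex-c′)
       | ac , ac≡b′c ← edge-ac (==-sound apex-b′)
    = edges⇒mono ab ac (trans ab≡bc′ (==-sound colour-c′)) (trans ac≡b′c (==-sound colour-b′))

  monos≤count : monos allVertices allVertices ≤ monoTriangleCount G
  monos≤count = begin
    ∑[ a < m ] ∑[ b < n ] ∑[ c < n ] 𝟙 (forcedMono a b c)
      ≤⟨ sum-mono-≤ (λ a → sum-mono-≤ λ b → sum-mono-≤ λ c → 𝟙-mono (forcedMono⇒mono a b c)) ⟩
    ∑[ a < m ] ∑[ b < n ] ∑[ c < n ] 𝟙 (isMonoTriangle G a b c)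
      ≡⟨ sumFin³≡∑∑∑ ⟨
    monoTriangleCount G ∎
    where
    open ≤-Reasoning
    sumFin³≡∑∑∑ : monoTriangleCount G ≡ ∑[ a < m ] ∑[ b < n ] ∑[ c < n ] 𝟙 (isMonoTriangle G a b c)
    sumFin³≡∑∑∑ = trans (sumFin≡sum m _) (sum-cong-≗ λ a → trans (sumFin≡sum n _) (sum-cong-≗ λ b →
      sumFin≡sum n (λ c → 𝟙 (isMonoTriangle G a b c))))

theorem7p1 : (r n m : ℕ) → 1 ≤ r → 1 ≤ n → 1 ≤ m →
    (G : TriGraph m n r) →
    (∀ b c → adj12 G b c ≡ true) →
    (T : Fin (n * n) → Triple m n) →
    (∀ i → IsMonoTriangle G (T i)) →
    (∀ i j → i ≢ j → ¬ ShareEdge (T i) (T j)) →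
    (∀ b c → ∃ λ i → (proj₁ (proj₂ (T i)) ≡ b) × (proj₂ (proj₂ (T i)) ≡ c)) →
    n ^ (3 + 2 ^ (r + 3)) ≤ monoTriangleCount G * (4 * m * r) ^ (2 ^ (r + 3))
theorem7p1 r n m r≥1 _ _ G complete tri mono disjoint covers =
  ≤-trans (monos-bound r≥1) (*-monoˡ-≤ _ monos≤count)
  where open TriangleDecomposition G complete tri mono disjoint covers
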